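{- Let $k\in\mathbb{N}$ and let $G$ be a graph with maximum degree $\Delta(G)=k$. Let $G^+$ be the graph obtained from $G$ by attaching, at every vertex $v$ of $G$, exactly $k+1-\deg_G(v)$ new pendant vertices (so that $\deg_{G^+}(v)=k+1$ for all $v\in V(G)$). Then $G$ admits a $k$-rs colouring if and only if $G^+$ admits a $(k+1)$-rs colouring.
   Context: All graphs are finite, simple and undirected. For $k\in\mathbb{N}$, a $k$-restricted star colouring ($k$-rs colouring) of $G$ is a map $f:V(G)\to\{0,\dots,k-1\}$ with $f(x)\neq f(y)$ for every edge $xy$ and with no path $x,y,z$ in $G$ (not necessarily induced) such that $f(y)>f(x)=f(z)$. -}

module Defs where

open import Data.Nat using (ℕ; zero; suc; _+_; _∸_; _≤_; _<_)
open import Data.Fin using (Fin; toℕ)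
open import Data.Bool using (Bool; true; false; if_then_else_)
open import Data.List using (List; map; allFin)
open import Data.Nat.ListAction using (sum)
open import Data.Product using (Σ; ∃; _×_; _,_)
open import Data.Sum using (_⊎_; inj₁; inj₂)
open import Data.Empty using (⊥)
open import Relation.Nullary using (¬_)
open import Relation.Binary.PropositionalEquality using (_≡_; _≢_)

record Graph (n : ℕ) : Set where
  field
    adj    : Fin n → Fin n → Bool
    sym    : ∀ u v → adj u v ≡ adj v u
    irrefl : ∀ v → adj v v ≡ false
open Graph public

Edge : ∀ {n} → Graph n → Fin n → Fin n → Set
Edge G u v = adj G u v ≡ true

deg : ∀ {n} → Graph n → Fin n → ℕ
deg {n} G v = sum (map (λ w → if adj G v w then 1 else 0) (allFin n))

-- Δ(G) = k  (the maximum degree of the empty graph is taken to be 0)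
MaxDegree : ∀ {n} → Graph n → ℕ → Set
MaxDegree {n} G k = (∀ v → deg G v ≤ k) × ((n ≡ 0 × k ≡ 0) ⊎ (∃ λ v → deg G v ≡ k))

-- Paths x,y,z have three distinct vertices (x ≢ z;
-- x ≢ y and y ≢ z are automatic for adjacent vertices in a simple graph).
IsRsColouring : {V : Set} → (V → V → Set) → (k : ℕ) → (V → Fin k) → Set
IsRsColouring {V} E k f =
  (∀ x y → E x y → f x ≢ f y) ×
  (∀ x y z → E x y → E y z → x ≢ z → f x ≡ f z → ¬ (toℕ (f x) < toℕ (f y)))

HasRsColouring : {V : Set} → (V → V → Set) → ℕ → Set
HasRsColouring {V} E k = Σ (V → Fin k) (IsRsColouring E k)

-- G⁺: vertices are the original vertices (inj₁ v) together with, for each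
-- v, exactly (k + 1 ∸ deg v) new pendant vertices (inj₂ (v , i)),
-- each adjacent only to v.
PlusVertex : ∀ {n} → Graph n → ℕ → Set
PlusVertex {n} G k = Fin n ⊎ Σ (Fin n) (λ v → Fin (suc k ∸ deg G v))

PlusEdge : ∀ {n} (G : Graph n) (k : ℕ) → PlusVertex G k → PlusVertex G k → Set
PlusEdge G k (inj₁ u) (inj₁ v) = Edge G u v
PlusEdge G k (inj₁ u) (inj₂ (v , _)) = u ≡ v
PlusEdge G k (inj₂ (u , _)) (inj₁ v) = u ≡ v
PlusEdge G k (inj₂ _) (inj₂ _) = ⊥

-- A k-rs colouring of G extends to G⁺ by giving every pendant vertex the new
-- colour k: the top colour can never be the repeated colour at the ends of a
-- bad path.  Conversely, in an rs colouring the neighbours of v coloured below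
-- v get pairwise distinct colours (else they would form a bad path through v),
-- so v has at most f v of them.  Every original vertex has k + 1 neighbours in
-- G⁺, so none of them receives the top colour k, and restricting a
-- (k+1)-rs colouring of G⁺ to G yields a k-rs colouring.
module Submission where

open import Defs hiding (sym)
open import Data.Nat using (ℕ; suc; _+_; _∸_; _≤_; _<_)
open import Data.Nat.Properties as ℕ using ()
open import Data.Nat.ListAction using (sum)
open import Data.Fin as Fin using (Fin; toℕ; inject₁; fromℕ; fromℕ<; lower₁)
open import Data.Fin.Properties as Fin using ()
open import Data.Bool using (Bool; true; false; if_then_else_)
open import Data.Bool.Properties using () renaming (_≟_ to _≟ᵇ_)
open import Data.Product using (_×_; _,_; proj₁; proj₂)
open import Data.Sum using (inj₁; inj₂)
open import Data.Sum.Properties using (inj₁-injective)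
open import Data.List using (List; []; _∷_; map; allFin; filter; length; _++_; lookup)
open import Data.List.Properties using (length-++; length-map; length-tabulate)
open import Data.List.Relation.Unary.All as All using (All)
import Data.List.Relation.Unary.All.Properties as All
open import Data.List.Relation.Unary.Unique.Propositional using (Unique; _∷_)
import Data.List.Relation.Unary.Unique.Propositional.Properties as Unique
open import Data.List.Membership.Propositional using (_∈_)
open import Data.List.Membership.Propositional.Properties using (∈-lookup; ∈-map⁻)
open import Data.Empty using (⊥-elim)
open import Function using (_∘_; id)
open import Function.Definitions using (Injective)
open import Relation.Nullary using (¬_; yes; no)
open import Relation.Binary.Definitions using (Symmetric)
open import Relation.Binary.PropositionalEquality

lookup-injective : {A : Set} {xs : List A} → Unique xs → Injective _≡_ _≡_ (lookup xs)
lookup-injective (_ ∷ _)    {Fin.zero}  {Fin.zero}  _  = refl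
lookup-injective (x∉xs ∷ _) {Fin.zero}  {Fin.suc j} eq = ⊥-elim (All.lookup x∉xs (∈-lookup j) eq)
lookup-injective (x∉xs ∷ _) {Fin.suc i} {Fin.zero}  eq = ⊥-elim (All.lookup x∉xs (∈-lookup i) (sym eq))
lookup-injective (_ ∷ xs!)  {Fin.suc i} {Fin.suc j} eq = cong Fin.suc (lookup-injective xs! eq)

length-filter≡sum-indicator : {A : Set} (b : A → Bool) (xs : List A) →
  length (filter (λ x → b x ≟ᵇ true) xs) ≡ sum (map (λ x → if b x then 1 else 0) xs)
length-filter≡sum-indicator b [] = refl
length-filter≡sum-indicator b (x ∷ xs) with b x
... | true  = cong suc (length-filter≡sum-indicator b xs)
... | false = length-filter≡sum-indicator b xs

module _ {V : Set} {E : V → V → Set} where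

  rsColouring-resp-toℕ : {c d : ℕ} {f : V → Fin d} {g : V → Fin c} →
    (∀ v → toℕ (f v) ≡ toℕ (g v)) → IsRsColouring E c g → IsRsColouring E d f
  rsColouring-resp-toℕ {f = f} {g} f≗g (proper , noBadPath) =
      (λ x y e eq → proper x y e (same-colour eq))
    , (λ x y z e₁ e₂ x≢z eq → noBadPath x y z e₁ e₂ x≢z (same-colour eq)
                              ∘ subst₂ _<_ (f≗g x) (f≗g y))
    where
    same-colour : ∀ {x y} → f x ≡ f y → g x ≡ g y
    same-colour {x} {y} eq = Fin.toℕ-injective (trans (sym (f≗g x)) (trans (cong toℕ eq) (f≗g y)))

  rsColouring-comap : {W : Set} {E′ : W → W → Set} {c : ℕ} {f : V → Fin c} {h : W → V} →
    Injective _≡_ _≡_ h → (∀ {x y} → E′ x y → E (h x) (h y)) →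
    IsRsColouring E c f → IsRsColouring E′ c (f ∘ h)
  rsColouring-comap h-inj h-hom (proper , noBadPath) =
      (λ x y e → proper _ _ (h-hom e))
    , (λ x y z e₁ e₂ x≢z → noBadPath _ _ _ (h-hom e₁) (h-hom e₂) (x≢z ∘ h-inj))

  rsColouring-lowerNeighbours≤ : {c m : ℕ} {f : V → Fin c} → Symmetric E → IsRsColouring E c f →
    {v : V} (nbr : Fin m → V) → Injective _≡_ _≡_ nbr →
    (∀ i → E v (nbr i)) → (∀ i → toℕ (f (nbr i)) < toℕ (f v)) → m ≤ toℕ (f v)
  rsColouring-lowerNeighbours≤ {f = f} E-sym (_ , noBadPath) {v} nbr nbr-inj adjacent below =
    Fin.injective⇒≤ colour-injective
    where
    colour-injective : Injective _≡_ _≡_ (λ i → fromℕ< (below i))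
    colour-injective {i} {j} eq with i Fin.≟ j
    ... | yes i≡j = i≡j
    ... | no  i≢j = ⊥-elim (noBadPath (nbr i) v (nbr j) (E-sym (adjacent i)) (adjacent j)
                              (i≢j ∘ nbr-inj)
                              (Fin.toℕ-injective (Fin.fromℕ<-injective _ _ (below i) (below j) eq))
                              (below i))

top-not< : ∀ {k} (a : Fin (suc k)) → ¬ (toℕ (fromℕ k) < toℕ a)
top-not< {k} a = subst (λ t → ¬ (t < toℕ a)) (sym (Fin.toℕ-fromℕ k)) (ℕ.≤⇒≯ (Fin.toℕ≤pred[n] a))

below-top : ∀ {k} (a b : Fin (suc k)) → k ≡ toℕ b → a ≢ b → toℕ a < toℕ b
below-top a b k≡b a≢b =
  ℕ.≤∧≢⇒< (subst (toℕ a ≤_) k≡b (Fin.toℕ≤pred[n] a)) (a≢b ∘ Fin.toℕ-injective)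

neighbours : ∀ {n} → Graph n → Fin n → List (Fin n)
neighbours {n} G v = filter (λ w → adj G v w ≟ᵇ true) (allFin n)

module _ {n : ℕ} (G : Graph n) (k : ℕ) where

  PlusEdge-sym : Symmetric (PlusEdge G k)
  PlusEdge-sym {inj₁ u} {inj₁ w} e = trans (Graph.sym G w u) e
  PlusEdge-sym {inj₁ _} {inj₂ _} e = sym e
  PlusEdge-sym {inj₂ _} {inj₁ _} e = sym e

  pendant : (v : Fin n) → Fin (suc k ∸ deg G v) → PlusVertex G k
  pendant v i = inj₂ (v , i)

  plusNeighbours : Fin n → List (PlusVertex G k)
  plusNeighbours v = map inj₁ (neighbours G v) ++ map (pendant v) (allFin (suc k ∸ deg G v))

  length-plusNeighbours : ∀ v → deg G v ≤ suc k → length (plusNeighbours v) ≡ suc k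
  length-plusNeighbours v deg≤ = begin
    length (plusNeighbours v)
      ≡⟨ length-++ (map inj₁ (neighbours G v)) ⟩
    length (map inj₁ (neighbours G v)) + length (map (pendant v) (allFin (suc k ∸ deg G v)))
      ≡⟨ cong₂ _+_ (length-map inj₁ (neighbours G v)) (length-map (pendant v) (allFin _)) ⟩
    length (neighbours G v) + length (allFin (suc k ∸ deg G v))
      ≡⟨ cong₂ _+_ (length-filter≡sum-indicator (adj G v) (allFin n)) (length-tabulate id) ⟩
    deg G v + (suc k ∸ deg G v)
      ≡⟨ ℕ.m+[n∸m]≡n deg≤ ⟩
    suc k ∎
    where open ≡-Reasoning

  plusNeighbours-unique : ∀ v → Unique (plusNeighbours v)
  plusNeighbours-unique v =
    Unique.++⁺ (Unique.map⁺ inj₁-injective (Unique.filter⁺ _ (Unique.allFin⁺ n)))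
               (Unique.map⁺ pendant-injective (Unique.allFin⁺ _))
               disjoint
    where
    pendant-injective : Injective _≡_ _≡_ (pendant v)
    pendant-injective refl = refl
    disjoint : ∀ {x} → ¬ (x ∈ map inj₁ (neighbours G v) × x ∈ map (pendant v) (allFin _))
    disjoint {x} (x∈orig , x∈pend) with ∈-map⁻ inj₁ x∈orig | ∈-map⁻ (pendant v) x∈pend
    ... | _ , _ , refl | _ , _ , ()

  plusNeighbours-adjacent : ∀ v → All (PlusEdge G k (inj₁ v)) (plusNeighbours v)
  plusNeighbours-adjacent v =
    All.++⁺ (All.map⁺ (All.all-filter _ (allFin n))) (All.map⁺ (All.tabulate (λ _ → refl)))

  extendByTopColour : (Fin n → Fin k) → PlusVertex G k → Fin (suc k)
  extendByTopColour f (inj₁ v) = inject₁ (f v)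
  extendByTopColour f (inj₂ _) = fromℕ k

  extendByTopColour-isRs : {f : Fin n → Fin k} → IsRsColouring (Edge G) k f →
    IsRsColouring (PlusEdge G k) (suc k) (extendByTopColour f)
  extendByTopColour-isRs {f} f-rs = proper , noBadPath
    where
    g : PlusVertex G k → Fin (suc k)
    g = extendByTopColour f

    raised-rs : IsRsColouring (Edge G) (suc k) (inject₁ ∘ f)
    raised-rs = rsColouring-resp-toℕ (Fin.toℕ-inject₁ ∘ f) f-rs

    proper : ∀ x y → PlusEdge G k x y → g x ≢ g y
    proper (inj₁ u) (inj₁ w) e   = proj₁ raised-rs u w e
    proper (inj₁ _) (inj₂ _) _ = Fin.fromℕ≢inject₁ ∘ sym
    proper (inj₂ _) (inj₁ _) _ = Fin.fromℕ≢inject₁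

    noBadPath : ∀ x y z → PlusEdge G k x y → PlusEdge G k y z → x ≢ z →
                g x ≡ g z → ¬ (toℕ (g x) < toℕ (g y))
    noBadPath (inj₂ _) y        _        _    _    _   _  = top-not< (g y)
    noBadPath (inj₁ x) (inj₁ y) (inj₁ z) e₁   e₂   x≢z    = proj₂ raised-rs x y z e₁ e₂ (x≢z ∘ cong inj₁)
    noBadPath (inj₁ _) (inj₁ _) (inj₂ _) _    _    _   eq = ⊥-elim (Fin.fromℕ≢inject₁ (sym eq))
    noBadPath (inj₁ _) (inj₂ _) (inj₁ _) refl refl x≢z    = ⊥-elim (x≢z refl)

  module _ (deg≤ : ∀ v → deg G v ≤ suc k)
           {g : PlusVertex G k → Fin (suc k)} (g-rs : IsRsColouring (PlusEdge G k) (suc k) g) where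

    original-not-top : ∀ v → k ≢ toℕ (g (inj₁ v))
    original-not-top v top = ℕ.≤⇒≯ (subst (_≤ _) (length-plusNeighbours v (deg≤ v)) nbrs≤colour)
                                      (subst (_< _) top (ℕ.n<1+n k))
      where
      nbr : Fin (length (plusNeighbours v)) → PlusVertex G k
      nbr = lookup (plusNeighbours v)
      adjacent : ∀ i → PlusEdge G k (inj₁ v) (nbr i)
      adjacent i = All.lookup (plusNeighbours-adjacent v) (∈-lookup i)
      nbrs≤colour : length (plusNeighbours v) ≤ toℕ (g (inj₁ v))
      nbrs≤colour = rsColouring-lowerNeighbours≤ PlusEdge-sym g-rs nbr
                      (lookup-injective (plusNeighbours-unique v)) adjacent
                      (λ i → below-top _ _ top (proj₁ g-rs _ _ (PlusEdge-sym (adjacent i))))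

    restriction : Fin n → Fin k
    restriction v = lower₁ (g (inj₁ v)) (original-not-top v)

    restriction-isRs : IsRsColouring (Edge G) k restriction
    restriction-isRs = rsColouring-resp-toℕ (λ v → Fin.toℕ-lower₁ _ (original-not-top v))
                         (rsColouring-comap inj₁-injective id g-rs)

mainTheorem18 : (k n : ℕ) (G : Graph n) → MaxDegree G k →
    (HasRsColouring (Edge G) k → HasRsColouring (PlusEdge G k) (suc k)) ×
    (HasRsColouring (PlusEdge G k) (suc k) → HasRsColouring (Edge G) k)
mainTheorem18 k n G (deg≤k , _) =
    (λ (f , f-rs) → extendByTopColour G k f , extendByTopColour-isRs G k f-rs)
  , (λ (g , g-rs) → restriction G k deg≤1+k g-rs , restriction-isRs G k deg≤1+k g-rs)
  where
  deg≤1+k : ∀ v → deg G v ≤ suc k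
  deg≤1+k v = ℕ.m≤n⇒m≤1+n (deg≤k v)
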